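{- In Algorithm I (see context), for every arriving constraint $h$, the number $t_h$ of primal update iterations performed for constraint $h$ satisfies $t_h\le 2\log k$, where $k$ is the value of the parameter $k$ when constraint $h$ arrives.
   Context: Online covering LP without upper bounds: $n$ variables with costs $c_i>0$; constraints $\sum_{i=1}^n a_{ij}x_i\ge 1$ ($a_{ij}\ge 0$) arrive one at a time, $j=1,2,\dots$; $T_j=\{i:a_{ij}>0\}$, assumed nonempty. $\log=\log_2$. Algorithm I (primal part): start with $x=0$. When constraint $h$ arrives, set $k$ to the smallest power of $2$ that is at least $\max\{2,|T_1|,\dots,|T_h|\}$. Let $d_{ih}=c_i/a_{ih}$ for $i\in T_h$ and $d_{m(h)}=\min_{i\in T_h}d_{ih}$. While $\sum_i a_{ih}x_i<1$, replace simultaneously for all $i\in T_h$: $x_i\leftarrow (1+d_{m(h)}/d_{ih})x_i+\frac{1}{k a_{ih}}\cdot\frac{d_{m(h)}}{d_{ih}}$. Let $t_h$ be the number of times this update is performed for constraint $h$.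
   Formalization: The costs $c_i$ and the coefficients $a_{ij}$ are rational. -}

module Defs where

open import Data.Nat as ℕ using (ℕ; zero; suc; _⊔_; _^_)
open import Data.Nat.Logarithm using (⌈log₂_⌉)
open import Data.Fin using (Fin)
open import Data.List using (List; []; _∷_; foldr; map; filter; length; upTo; allFin)
open import Data.Integer using (+_)
open import Data.Rational using (ℚ; 0ℚ; 1ℚ; _+_; _*_; _≤_; _<_; _⊓_; _/_; ≢-nonZero)
import Data.Rational as ℚ
open import Data.Rational.Properties using (_<?_; _≟_)
open import Relation.Nullary using (yes; no; ¬_)

-- Total division on ℚ (q ÷₀ 0 = 0); it is only ever applied to nonzero divisors below.
_÷₀_ : ℚ → ℚ → ℚ
p ÷₀ q with q ≟ 0ℚ
... | yes _ = 0ℚ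
... | no q≢0 = ℚ._÷_ p q {{≢-nonZero q≢0}}

fromℕ : ℕ → ℚ
fromℕ m = (+ m) / 1

supp : ∀ {n} → (Fin n → ℚ) → List (Fin n)
supp {n} a = filter (λ i → 0ℚ <? a i) (allFin n)

suppSize : ∀ {n} → (Fin n → ℚ) → ℕ
suppSize a = length (supp a)

-- Constraints are indexed by ℕ starting at 0 (index j here = constraint j+1 of the paper).
-- M_h = max {2, |T_0|, ..., |T_h|}
maxSupp : ∀ {n} → (ℕ → Fin n → ℚ) → ℕ → ℕ
maxSupp a h = foldr _⊔_ 2 (map (λ j → suppSize (a j)) (upTo (suc h)))

kParam : ∀ {n} → (ℕ → Fin n → ℚ) → ℕ → ℕ
kParam a h = 2 ^ ⌈log₂ (maxSupp a h) ⌉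

-- minimum of a list (0 on the empty list; only used on nonempty lists)
minList : List ℚ → ℚ
minList [] = 0ℚ
minList (x ∷ xs) = foldr _⊓_ x xs

module Algorithm {n : ℕ} (c : Fin n → ℚ) (a : ℕ → Fin n → ℚ) where

  lhs : ℕ → (Fin n → ℚ) → ℚ
  lhs h x = foldr (λ i acc → a h i * x i + acc) 0ℚ (allFin n)

  Satisfied : ℕ → (Fin n → ℚ) → Set
  Satisfied h x = 1ℚ ≤ lhs h x

  d : ℕ → Fin n → ℚ
  d h i = c i ÷₀ a h i

  dmin : ℕ → ℚ
  dmin h = minList (map (d h) (supp (a h)))

  update : ℕ → (Fin n → ℚ) → (Fin n → ℚ)
  update h x i with 0ℚ <? a h i
  ... | no _ = x i
  ... | yes _ = (1ℚ + r) * x i + (1ℚ ÷₀ (fromℕ (kParam a h) * a h i)) * r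
    where r = dmin h ÷₀ d h i

  data Loop (h : ℕ) : (Fin n → ℚ) → ℕ → (Fin n → ℚ) → Set where
    done : ∀ {x} → Satisfied h x → Loop h x 0 x
    step : ∀ {x t x'} → ¬ Satisfied h x → Loop h (update h x) t x' → Loop h x (suc t) x'

  -- Reach h x : x is the primal vector when constraint h arrives
  -- (after constraints 0 .. h-1 have been processed), starting from x = 0.
  data Reach : ℕ → (Fin n → ℚ) → Set where
    start : Reach 0 (λ _ → 0ℚ)
    next  : ∀ {h x t x'} → Reach h x → Loop h x t x' → Reach (suc h) x'

-- Let m ∈ T_h attain d_{m(h)}.  Its ratio d_{m(h)}/d_{mh} is 1, so each update sends x_m to
-- 2 x_m + e with e = 1/(k a_{mh}): the quantity x_m + e doubles.  All coordinates stay
-- nonnegative, so it starts at least e, and after log k + 1 ≤ 2 log k updates (k ≥ 2) it is at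
-- least 2k e = 2/a_{mh}; then a_{mh} x_m ≥ 2 - 1/k ≥ 1 and constraint h holds.

{-# OPTIONS --safe #-}
module Submission where

open import Defs
open import Data.Nat using (ℕ; _*_; _≤_)
open import Data.Nat.Logarithm using (⌊log₂_⌋)
open import Data.Fin using (Fin)
open import Data.Product using (∃; ∃₂; _×_)
open import Data.Rational using (ℚ; 0ℚ)
import Data.Rational as ℚ

import Data.Nat as ℕ
import Data.Nat.Properties as ℕP
open import Data.Nat.Logarithm using (⌈log₂_⌉; ⌊log₂[2^n]⌋≡n; ⌈log₂⌉-mono-≤)
open import Data.Integer as ℤ using (+_)
import Data.Integer.Properties as ℤP
import Data.Integer.Solver
open import Data.Rational using (1ℚ)
import Data.Rational.Properties as ℚP
import Data.Rational.Unnormalised as ℚᵘ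
import Data.Rational.Unnormalised.Properties as ℚᵘP
import Data.Rational.Solver
open import Data.List using (List; []; _∷_; foldr; map; upTo; allFin)
open import Data.List.Membership.Propositional using (_∈_)
open import Data.List.Membership.Propositional.Properties using (∈-map⁻; ∈-filter⁺; ∈-filter⁻; ∈-allFin)
open import Data.List.Relation.Unary.Any using (here; there)
open import Data.Product using (_,_; proj₁; proj₂)
open import Data.Sum using (inj₁; inj₂)
open import Data.Empty using (⊥-elim)
open import Relation.Nullary using (yes; no)
open import Relation.Binary.PropositionalEquality
  using (_≡_; _≢_; refl; sym; trans; cong; cong₂; subst)

fromℕ-+ : ∀ m n → fromℕ (m ℕ.+ n) ≡ fromℕ m ℚ.+ fromℕ n
fromℕ-+ m n = ℚP.toℚᵘ-injective (begin
  ℚ.toℚᵘ (fromℕ (m ℕ.+ n))               ≈⟨ ℚP.toℚᵘ-fromℚᵘ (integer (m ℕ.+ n)) ⟩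
  integer (m ℕ.+ n)                      ≈⟨ ℚᵘ.*≡* cross ⟩
  integer m ℚᵘ.+ integer n               ≈⟨ ℚᵘP.+-cong (ℚᵘP.≃-sym (ℚP.toℚᵘ-fromℚᵘ (integer m)))
                                                         (ℚᵘP.≃-sym (ℚP.toℚᵘ-fromℚᵘ (integer n))) ⟩
  ℚ.toℚᵘ (fromℕ m) ℚᵘ.+ ℚ.toℚᵘ (fromℕ n) ≈⟨ ℚᵘP.≃-sym (ℚP.toℚᵘ-homo-+ (fromℕ m) (fromℕ n)) ⟩
  ℚ.toℚᵘ (fromℕ m ℚ.+ fromℕ n)           ∎)
  where
  open ℚᵘP.≃-Reasoning
  integer : ℕ → ℚᵘ.ℚᵘ
  integer k = ℚᵘ.mkℚᵘ (+ k) 0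
  cross : + (m ℕ.+ n) ℤ.* + 1 ≡ (+ m ℤ.* + 1 ℤ.+ + n ℤ.* + 1) ℤ.* + 1
  cross = trans (cong (ℤ._* + 1) (ℤP.pos-+ m n))
    (solve 2 (λ p q → (p :+ q) :* con (+ 1) := (p :* con (+ 1) :+ q :* con (+ 1)) :* con (+ 1)) refl (+ m) (+ n))
    where open Data.Integer.Solver.+-*-Solver

fromℕ-nonNeg : ∀ m → 0ℚ ℚ.≤ fromℕ m
fromℕ-nonNeg m = ℚP.nonNegative⁻¹ _ {{ℚP.normalize-nonNeg m 1}}

1≤fromℕ : ∀ {m} → 1 ≤ m → 1ℚ ℚ.≤ fromℕ m
1≤fromℕ {ℕ.suc m} _ = begin
  1ℚ               ≡⟨ sym (ℚP.+-identityʳ 1ℚ) ⟩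
  1ℚ ℚ.+ 0ℚ        ≤⟨ ℚP.+-monoʳ-≤ 1ℚ (fromℕ-nonNeg m) ⟩
  1ℚ ℚ.+ fromℕ m   ≡⟨ sym (fromℕ-+ 1 m) ⟩
  fromℕ (ℕ.suc m)  ∎
  where open ℚP.≤-Reasoning

fromℕ-2^-suc : ∀ s → fromℕ (2 ℕ.^ ℕ.suc s) ≡ fromℕ (2 ℕ.^ s) ℚ.+ fromℕ (2 ℕ.^ s)
fromℕ-2^-suc s = trans (cong (λ k → fromℕ (2 ℕ.^ s ℕ.+ k)) (ℕP.+-identityʳ (2 ℕ.^ s)))
                       (fromℕ-+ (2 ℕ.^ s) (2 ℕ.^ s))

0≤1 : 0ℚ ℚ.≤ 1ℚ
0≤1 = ℚP.<⇒≤ (ℚP.positive⁻¹ 1ℚ)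

+-cancelʳ-≤ : ∀ {p q} r → p ℚ.+ r ℚ.≤ q ℚ.+ r → p ℚ.≤ q
+-cancelʳ-≤ {p} {q} r p+r≤q+r = begin
  p                       ≡⟨ solve 2 (λ p r → p := (p :+ r) :+ :- r) refl p r ⟩
  (p ℚ.+ r) ℚ.+ ℚ.- r     ≤⟨ ℚP.+-monoˡ-≤ (ℚ.- r) p+r≤q+r ⟩
  (q ℚ.+ r) ℚ.+ ℚ.- r     ≡⟨ solve 2 (λ q r → (q :+ r) :+ :- r := q) refl q r ⟩
  q                       ∎
  where open ℚP.≤-Reasoning; open Data.Rational.Solver.+-*-Solver

÷₀-nonZero : ∀ p {q} (q≢0 : q ≢ 0ℚ) → p ÷₀ q ≡ ℚ._÷_ p q {{ℚ.≢-nonZero q≢0}}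
÷₀-nonZero p {q} q≢0 with q ℚP.≟ 0ℚ
... | yes q≡0 = ⊥-elim (q≢0 q≡0)
... | no _    = refl

*-nonNeg : ∀ {p q} → 0ℚ ℚ.≤ p → 0ℚ ℚ.≤ q → 0ℚ ℚ.≤ p ℚ.* q
*-nonNeg {p} {q} 0≤p 0≤q =
  ℚP.nonNegative⁻¹ _ {{ℚP.nonNeg*nonNeg⇒nonNeg p {{ℚ.nonNegative 0≤p}} q {{ℚ.nonNegative 0≤q}}}}

1/-pos : ∀ q .{{_ : ℚ.NonZero q}} → 0ℚ ℚ.< q → 0ℚ ℚ.< ℚ.1/ q
1/-pos (ℚ.mkℚ ℤ.+[1+ _ ] _ _) _          = ℚP.positive⁻¹ _
1/-pos (ℚ.mkℚ ℤ.-[1+ _ ] _ _) (ℚ.*<* ())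

÷₀-nonNeg : ∀ {p q} → 0ℚ ℚ.≤ p → 0ℚ ℚ.≤ q → 0ℚ ℚ.≤ p ÷₀ q
÷₀-nonNeg {p} {q} 0≤p 0≤q with q ℚP.≟ 0ℚ
... | yes _  = ℚP.≤-refl
... | no q≢0 = *-nonNeg 0≤p (ℚP.<⇒≤ (1/-pos q 0<q))
  where
  instance _ = ℚ.≢-nonZero q≢0
  0<q = ℚP.positive⁻¹ q {{ℚP.nonNeg∧nonZero⇒pos q {{ℚ.nonNegative 0≤q}}}}

÷₀-pos : ∀ {p q} → 0ℚ ℚ.< p → 0ℚ ℚ.< q → 0ℚ ℚ.< p ÷₀ q
÷₀-pos {p} {q} 0<p 0<q = subst (0ℚ ℚ.<_) (sym (÷₀-nonZero p q≢0))
  (ℚP.positive⁻¹ _ {{ℚP.pos*pos⇒pos p {{ℚ.positive 0<p}} (ℚ.1/ q) {{ℚ.positive (1/-pos q 0<q)}}}})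
  where
  q≢0 = λ q≡0 → ℚP.<⇒≢ 0<q (sym q≡0)
  instance _ = ℚ.≢-nonZero q≢0

÷₀-self : ∀ {q} → q ≢ 0ℚ → q ÷₀ q ≡ 1ℚ
÷₀-self {q} q≢0 = trans (÷₀-nonZero q q≢0) (ℚP.*-inverseʳ q {{ℚ.≢-nonZero q≢0}})

*-÷₀-inverseʳ : ∀ {q} → q ≢ 0ℚ → q ℚ.* (1ℚ ÷₀ q) ≡ 1ℚ
*-÷₀-inverseʳ {q} q≢0 = trans (cong (q ℚ.*_) (trans (÷₀-nonZero 1ℚ q≢0) (ℚP.*-identityˡ _)))
                                (ℚP.*-inverseʳ q {{ℚ.≢-nonZero q≢0}})

1≤a*x-from-2Ke≤x+e : ∀ {K a x e} → 1ℚ ℚ.≤ K → 0ℚ ℚ.≤ a → 0ℚ ℚ.≤ e → (K ℚ.* a) ℚ.* e ≡ 1ℚ →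
                     (K ℚ.+ K) ℚ.* e ℚ.≤ x ℚ.+ e → 1ℚ ℚ.≤ a ℚ.* x
1≤a*x-from-2Ke≤x+e {K} {a} {x} {e} 1≤K 0≤a 0≤e Kae≡1 2Ke≤x+e = +-cancelʳ-≤ (a ℚ.* e) (begin
  1ℚ ℚ.+ a ℚ.* e                          ≤⟨ ℚP.+-monoʳ-≤ 1ℚ ae≤1 ⟩
  1ℚ ℚ.+ 1ℚ                               ≡⟨ sym (cong₂ ℚ._+_ Kae≡1 Kae≡1) ⟩
  (K ℚ.* a) ℚ.* e ℚ.+ (K ℚ.* a) ℚ.* e     ≡⟨ solve 3 (λ K a e → (K :* a) :* e :+ (K :* a) :* e := a :* ((K :+ K) :* e))
                                                      refl K a e ⟩
  a ℚ.* ((K ℚ.+ K) ℚ.* e)                 ≤⟨ ℚP.*-monoˡ-≤-nonNeg a {{ℚ.nonNegative 0≤a}} 2Ke≤x+e ⟩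
  a ℚ.* (x ℚ.+ e)                         ≡⟨ ℚP.*-distribˡ-+ a x e ⟩
  a ℚ.* x ℚ.+ a ℚ.* e                     ∎)
  where
  open ℚP.≤-Reasoning
  open Data.Rational.Solver.+-*-Solver
  ae≤1 : a ℚ.* e ℚ.≤ 1ℚ
  ae≤1 = begin
    a ℚ.* e             ≡⟨ sym (ℚP.*-identityˡ (a ℚ.* e)) ⟩
    1ℚ ℚ.* (a ℚ.* e)    ≤⟨ ℚP.*-monoʳ-≤-nonNeg (a ℚ.* e) {{ℚ.nonNegative (*-nonNeg 0≤a 0≤e)}} 1≤K ⟩
    K ℚ.* (a ℚ.* e)     ≡⟨ sym (ℚP.*-assoc K a e) ⟩
    (K ℚ.* a) ℚ.* e     ≡⟨ Kae≡1 ⟩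
    1ℚ                  ∎

minList-∈ : ∀ x xs → minList (x ∷ xs) ∈ x ∷ xs
minList-∈ x []       = here refl
minList-∈ x (y ∷ ys) with ℚP.⊓-sel y (foldr ℚ._⊓_ x ys)
... | inj₁ min≡y = there (here min≡y)
... | inj₂ min≡rest with minList-∈ x ys
...   | here p  = here (trans min≡rest p)
...   | there p = there (there (subst (_∈ ys) (sym min≡rest) p))

minList-map-attained : ∀ {A : Set} (f : A → ℚ) {i} {l : List A} → i ∈ l →
                       ∃ λ m → m ∈ l × minList (map f l) ≡ f m
minList-map-attained f {l = y ∷ ys} _ = ∈-map⁻ f (minList-∈ (f y) (map f ys))

minList-map-nonNeg : ∀ {A : Set} (f : A → ℚ) (l : List A) → (∀ i → 0ℚ ℚ.≤ f i) →
                     0ℚ ℚ.≤ minList (map f l)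
minList-map-nonNeg f []       _     = ℚP.≤-refl
minList-map-nonNeg f (y ∷ ys) 0≤f with minList-map-attained f {l = y ∷ ys} (here refl)
... | m , _ , min≡fm = subst (0ℚ ℚ.≤_) (sym min≡fm) (0≤f m)

module _ {A : Set} (f : A → ℚ) (0≤f : ∀ i → 0ℚ ℚ.≤ f i) where

  private
    sum : List A → ℚ
    sum = foldr (λ i acc → f i ℚ.+ acc) 0ℚ

  foldr-+-nonNeg : ∀ l → 0ℚ ℚ.≤ foldr (λ i acc → f i ℚ.+ acc) 0ℚ l
  foldr-+-nonNeg []       = ℚP.≤-refl
  foldr-+-nonNeg (y ∷ ys) = ℚP.+-mono-≤ (0≤f y) (foldr-+-nonNeg ys)

  ∈⇒≤-foldr-+ : ∀ {m l} → m ∈ l → f m ℚ.≤ foldr (λ i acc → f i ℚ.+ acc) 0ℚ l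
  ∈⇒≤-foldr-+ {m} {y ∷ ys} (here refl) = begin
    f y              ≡⟨ sym (ℚP.+-identityʳ (f y)) ⟩
    f y ℚ.+ 0ℚ       ≤⟨ ℚP.+-monoʳ-≤ (f y) (foldr-+-nonNeg ys) ⟩
    f y ℚ.+ sum ys   ∎
    where open ℚP.≤-Reasoning
  ∈⇒≤-foldr-+ {m} {y ∷ ys} (there m∈ys) = begin
    f m              ≤⟨ ∈⇒≤-foldr-+ m∈ys ⟩
    sum ys           ≡⟨ sym (ℚP.+-identityˡ (sum ys)) ⟩
    0ℚ ℚ.+ sum ys    ≤⟨ ℚP.+-monoˡ-≤ (sum ys) (0≤f y) ⟩
    f y ℚ.+ sum ys   ∎
    where open ℚP.≤-Reasoning

≤-foldr-⊔ : ∀ b l → b ≤ foldr ℕ._⊔_ b l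
≤-foldr-⊔ b []       = ℕP.≤-refl
≤-foldr-⊔ b (y ∷ ys) = ℕP.≤-trans (≤-foldr-⊔ b ys) (ℕP.m≤n⊔m y _)

module _ {n} (c : Fin n → ℚ) (a : ℕ → Fin n → ℚ) where
  open Algorithm c a

  loop-within : ∀ h (I : ℕ → (Fin n → ℚ) → Set) →
                (∀ s {x} → I (ℕ.suc s) x → I s (update h x)) →
                (∀ {x} → I 0 x → Satisfied h x) →
                ∀ s x → I s x → ∃₂ λ t x' → Loop h x t x' × t ≤ s
  loop-within h I step-inv sat-inv s x Isx with 1ℚ ℚP.≤? lhs h x
  ... | yes sat = 0 , x , done sat , ℕ.z≤n
  loop-within h I step-inv sat-inv 0         x Isx | no unsat = ⊥-elim (unsat (sat-inv Isx))
  loop-within h I step-inv sat-inv (ℕ.suc s) x Isx | no unsat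
    with loop-within h I step-inv sat-inv s (update h x) (step-inv s Isx)
  ... | t , x' , loop , t≤s = ℕ.suc t , x' , step unsat loop , ℕ.s≤s t≤s

module Analysis {n} (c : Fin n → ℚ) (a : ℕ → Fin n → ℚ)
                (0<c : ∀ i → 0ℚ ℚ.< c i) (0≤a : ∀ j i → 0ℚ ℚ.≤ a j i)
                (T≢∅ : ∀ j → ∃ λ i → 0ℚ ℚ.< a j i) where
  open Algorithm c a

  NonNeg : (Fin n → ℚ) → Set
  NonNeg x = ∀ i → 0ℚ ℚ.≤ x i

  d-nonNeg : ∀ h i → 0ℚ ℚ.≤ d h i
  d-nonNeg h i = ÷₀-nonNeg (ℚP.<⇒≤ (0<c i)) (0≤a h i)

  dmin-nonNeg : ∀ h → 0ℚ ℚ.≤ dmin h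
  dmin-nonNeg h = minList-map-nonNeg (d h) (supp (a h)) (d-nonNeg h)

  update-nonNeg : ∀ h {x} → NonNeg x → NonNeg (update h x)
  update-nonNeg h {x} 0≤x i with 0ℚ ℚP.<? a h i
  ... | no _  = 0≤x i
  ... | yes _ = ℚP.+-mono-≤ (*-nonNeg (ℚP.+-mono-≤ 0≤1 0≤r) (0≤x i))
                            (*-nonNeg (÷₀-nonNeg 0≤1
                                                 (*-nonNeg (fromℕ-nonNeg (kParam a h)) (0≤a h i))) 0≤r)
    where 0≤r = ÷₀-nonNeg (dmin-nonNeg h) (d-nonNeg h i)

  loop-nonNeg : ∀ {h x t x'} → NonNeg x → Loop h x t x' → NonNeg x'
  loop-nonNeg 0≤x (done _)      = 0≤x
  loop-nonNeg 0≤x (step _ loop) = loop-nonNeg (update-nonNeg _ 0≤x) loop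

  reach-nonNeg : ∀ {h x} → Reach h x → NonNeg x
  reach-nonNeg start             _ = ℚP.≤-refl
  reach-nonNeg (next reach loop)   = loop-nonNeg (reach-nonNeg reach) loop

  -- Opaque: unfolding fromℕ (kParam a h) makes checking equations about update prohibitively slow.
  opaque
    kℚ : ℕ → ℚ
    kℚ h = fromℕ (kParam a h)

    fromℕ-k≡kℚ : ∀ h → fromℕ (kParam a h) ≡ kℚ h
    fromℕ-k≡kℚ h = refl

  update-supp : ∀ h {x i} → 0ℚ ℚ.< a h i → update h x i ≡
    (1ℚ ℚ.+ dmin h ÷₀ d h i) ℚ.* x i ℚ.+ (1ℚ ÷₀ (kℚ h ℚ.* a h i)) ℚ.* (dmin h ÷₀ d h i)
  update-supp h {x} {i} 0<aᵢ with 0ℚ ℚP.<? a h i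
  ... | yes _    = cong (λ k → (1ℚ ℚ.+ dmin h ÷₀ d h i) ℚ.* x i ℚ.+ (1ℚ ÷₀ (k ℚ.* a h i)) ℚ.* (dmin h ÷₀ d h i))
                        (fromℕ-k≡kℚ h)
  ... | no ¬0<aᵢ = ⊥-elim (¬0<aᵢ 0<aᵢ)

  module AtConstraint (h : ℕ) where

    argmin : ∃ λ m → m ∈ supp (a h) × dmin h ≡ d h m
    argmin = minList-map-attained (d h)
               (∈-filter⁺ (λ i → 0ℚ ℚP.<? a h i) (∈-allFin (proj₁ (T≢∅ h))) (proj₂ (T≢∅ h)))

    m : Fin n
    m = proj₁ argmin

    0<aₘ : 0ℚ ℚ.< a h m
    0<aₘ = proj₂ (∈-filter⁻ (λ i → 0ℚ ℚP.<? a h i) {xs = allFin n} (proj₁ (proj₂ argmin)))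

    dmin÷dₘ≡1 : dmin h ÷₀ d h m ≡ 1ℚ
    dmin÷dₘ≡1 = trans (cong (_÷₀ d h m) (proj₂ (proj₂ argmin)))
                      (÷₀-self (λ dₘ≡0 → ℚP.<⇒≢ (÷₀-pos (0<c m) 0<aₘ) (sym dₘ≡0)))

    L : ℕ
    L = ⌈log₂ (maxSupp a h) ⌉

    K : ℚ
    K = kℚ h

    1≤K : 1ℚ ℚ.≤ K
    1≤K = subst (1ℚ ℚ.≤_) (fromℕ-k≡kℚ h) (1≤fromℕ (ℕP.m^n>0 2 L))

    0≤K : 0ℚ ℚ.≤ K
    0≤K = ℚP.≤-trans 0≤1 1≤K

    fromℕ-2^[1+L]≡K+K : fromℕ (2 ℕ.^ ℕ.suc L) ≡ K ℚ.+ K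
    fromℕ-2^[1+L]≡K+K = trans (fromℕ-2^-suc L) (cong₂ ℚ._+_ (fromℕ-k≡kℚ h) (fromℕ-k≡kℚ h))

    e : ℚ
    e = 1ℚ ÷₀ (K ℚ.* a h m)

    0≤e : 0ℚ ℚ.≤ e
    0≤e = ÷₀-nonNeg 0≤1 (*-nonNeg 0≤K (0≤a h m))

    Kaₘe≡1 : (K ℚ.* a h m) ℚ.* e ≡ 1ℚ
    Kaₘe≡1 = *-÷₀-inverseʳ (λ Kaₘ≡0 → ℚP.<⇒≢ 0<Kaₘ (sym Kaₘ≡0))
      where
      0<Kaₘ : 0ℚ ℚ.< K ℚ.* a h m
      0<Kaₘ = ℚP.positive⁻¹ _ {{ℚP.pos*pos⇒pos K {{ℚ.positive (ℚP.<-≤-trans (ℚP.positive⁻¹ 1ℚ) 1≤K)}}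
                                                  (a h m) {{ℚ.positive 0<aₘ}}}}

    update-argmin : ∀ x → update h x m ≡ (1ℚ ℚ.+ 1ℚ) ℚ.* x m ℚ.+ e ℚ.* 1ℚ
    update-argmin x = trans (update-supp h 0<aₘ) (cong (λ r → (1ℚ ℚ.+ r) ℚ.* x m ℚ.+ e ℚ.* r) dmin÷dₘ≡1)

    Potential : ℕ → (Fin n → ℚ) → Set
    Potential s x = NonNeg x × (K ℚ.+ K) ℚ.* e ℚ.≤ fromℕ (2 ℕ.^ s) ℚ.* (x m ℚ.+ e)

    potential-update : ∀ s {x} → Potential (ℕ.suc s) x → Potential s (update h x)
    potential-update s {x} (0≤x , bound) = update-nonNeg h 0≤x , (begin
      (K ℚ.+ K) ℚ.* e                          ≤⟨ bound ⟩
      fromℕ (2 ℕ.^ ℕ.suc s) ℚ.* (x m ℚ.+ e)    ≡⟨ cong (ℚ._* (x m ℚ.+ e)) (fromℕ-2^-suc s) ⟩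
      (F ℚ.+ F) ℚ.* (x m ℚ.+ e)                ≡⟨ solve 3 (λ F y e → (F :+ F) :* (y :+ e)
                                                     := F :* ((con 1ℚ :+ con 1ℚ) :* y :+ e :* con 1ℚ :+ e)) refl F (x m) e ⟩
      F ℚ.* ((1ℚ ℚ.+ 1ℚ) ℚ.* x m ℚ.+ e ℚ.* 1ℚ ℚ.+ e) ≡⟨ cong (λ y → F ℚ.* (y ℚ.+ e)) (sym (update-argmin x)) ⟩
      F ℚ.* (update h x m ℚ.+ e)               ∎)
      where
      open ℚP.≤-Reasoning
      open Data.Rational.Solver.+-*-Solver
      F = fromℕ (2 ℕ.^ s)

    potential-start : ∀ {x} → NonNeg x → Potential (ℕ.suc L) x
    potential-start {x} 0≤x = 0≤x , (begin
      (K ℚ.+ K) ℚ.* e                          ≤⟨ ℚP.*-monoˡ-≤-nonNeg (K ℚ.+ K) {{ℚ.nonNegative 0≤K+K}} e≤xₘ+e ⟩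
      (K ℚ.+ K) ℚ.* (x m ℚ.+ e)                ≡⟨ cong (ℚ._* (x m ℚ.+ e)) (sym fromℕ-2^[1+L]≡K+K) ⟩
      fromℕ (2 ℕ.^ ℕ.suc L) ℚ.* (x m ℚ.+ e)    ∎)
      where
      open ℚP.≤-Reasoning
      0≤K+K = ℚP.+-mono-≤ 0≤K 0≤K
      e≤xₘ+e = ℚP.≤-trans (ℚP.≤-reflexive (sym (ℚP.+-identityˡ e))) (ℚP.+-monoˡ-≤ e (0≤x m))

    potential-satisfied : ∀ {x} → Potential 0 x → Satisfied h x
    potential-satisfied {x} (0≤x , bound) = ℚP.≤-trans 1≤aₘxₘ (∈⇒≤-foldr-+ (λ i → a h i ℚ.* x i)
                                                (λ i → *-nonNeg (0≤a h i) (0≤x i)) (∈-allFin m))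
      where
      1≤aₘxₘ = 1≤a*x-from-2Ke≤x+e 1≤K (0≤a h m) 0≤e Kaₘe≡1
                 (ℚP.≤-trans bound (ℚP.≤-reflexive (ℚP.*-identityˡ (x m ℚ.+ e))))

    loop-length≤1+L : ∀ {x} → Reach h x → ∃₂ λ t x' → Loop h x t x' × t ≤ ℕ.suc L
    loop-length≤1+L {x} reach = loop-within c a h Potential potential-update potential-satisfied
                                  (ℕ.suc L) x (potential-start (reach-nonNeg reach))

    1+L≤2log₂k : ℕ.suc L ≤ 2 * ⌊log₂ (kParam a h) ⌋
    1+L≤2log₂k rewrite ⌊log₂[2^n]⌋≡n L | ℕP.+-identityʳ L = ℕP.+-monoˡ-≤ L 1≤L
      where 1≤L = ⌈log₂⌉-mono-≤ (≤-foldr-⊔ 2 (map (λ j → suppSize (a j)) (upTo (ℕ.suc h))))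

lemma1 : ∀ {n} (c : Fin n → ℚ) (a : ℕ → Fin n → ℚ)
         → (∀ i → 0ℚ ℚ.< c i)
         → (∀ j i → 0ℚ ℚ.≤ a j i)
         → (∀ j → ∃ λ i → 0ℚ ℚ.< a j i)
         → ∀ h x → Algorithm.Reach c a h x
         → ∃₂ λ t x' → Algorithm.Loop c a h x t x' × t ≤ 2 * ⌊log₂ (kParam a h) ⌋
lemma1 c a 0<c 0≤a T≢∅ h x reach =
  let t , x' , loop , t≤1+L = loop-length≤1+L reach
  in  t , x' , loop , ℕP.≤-trans t≤1+L 1+L≤2log₂k
  where open Analysis.AtConstraint c a 0<c 0≤a T≢∅ h
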